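{- Let $P$ be a finite poset of length $1$ with $|P|\ge2$ and connected Hasse diagram. Then $U_P$ is Gorenstein if and only if $U_P$ is $\mathbb{Q}$-Gorenstein.
   Context: Length $1$ means every element is minimal or maximal. Identify $P$ with $[n]$; $N=\mathbb{Z}^n/\mathbb{Z}(1,\dots,1)$, $N_{\mathbb{R}}=N\otimes\mathbb{R}$, $M$ the dual lattice. The braid cone is $\sigma_P=\{x\in N_{\mathbb{R}}: x_i\le x_j\text{ whenever } i<_P j\}$ and $U_P$ its affine toric variety. $U_P$ is $\mathbb{Q}$-Gorenstein if there exist $u\in M$ and a positive integer $r$ with $\langle u,v\rangle=r$ for every ray generator $v$ of $\sigma_P$, and Gorenstein if this holds with $r=1$. -}

module Defs where

open import Data.Nat using (ℕ; zero; suc)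
open import Data.Integer using (ℤ; +_; _+_; _*_; _≤_)
open import Data.Fin using (Fin)
import Data.Fin as F
open import Data.Bool using (Bool; T)
open import Data.Product using (Σ; ∃; _×_; _,_)
open import Data.Sum using (_⊎_)
open import Data.Empty using (⊥)
open import Relation.Nullary using (¬_)
open import Relation.Binary.PropositionalEquality using (_≡_; _≢_)
open import Relation.Binary.Construct.Closure.ReflexiveTransitive using (Star)

record FinPoset (n : ℕ) : Set where
  field
    lt      : Fin n → Fin n → Bool
    irrefl  : ∀ i → ¬ T (lt i i)
    trans   : ∀ i j k → T (lt i j) → T (lt j k) → T (lt i k)

module _ {n : ℕ} (P : FinPoset n) where
  open FinPoset P

  _<P_ : Fin n → Fin n → Set
  i <P j = T (lt i j)

  Length1 : Set
  Length1 = ∀ i → (∀ j → ¬ (j <P i)) ⊎ (∀ j → ¬ (i <P j))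

  Covers : Fin n → Fin n → Set
  Covers i j = i <P j × (∀ k → ¬ (i <P k × k <P j))

  HasseConnected : Set
  HasseConnected = ∀ i j → Star (λ a b → Covers a b ⊎ Covers b a) i j

-- Vectors in ℤ^n; N = ℤ^n / ℤ(1,…,1), elements represented by vectors.
Vecℤ : ℕ → Set
Vecℤ n = Fin n → ℤ

sumℤ : ∀ {n} → Vecℤ n → ℤ
sumℤ {zero}  v = + 0
sumℤ {suc n} v = v F.zero + sumℤ (λ i → v (F.suc i))

_≈N_ : ∀ {n} → Vecℤ n → Vecℤ n → Set
_≈N_ {n} x y = Σ ℤ λ c → ∀ i → x i ≡ y i + c

_⊕_ : ∀ {n} → Vecℤ n → Vecℤ n → Vecℤ n
(x ⊕ y) i = x i + y i

_·_ : ∀ {n} → ℕ → Vecℤ n → Vecℤ n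
(k · x) i = + k * x i

zeroV : ∀ {n} → Vecℤ n
zeroV i = + 0

-- M = dual lattice of N = {u ∈ ℤ^n : Σ u_i = 0}
InM : ∀ {n} → Vecℤ n → Set
InM u = sumℤ u ≡ + 0

⟨_,_⟩ : ∀ {n} → Vecℤ n → Vecℤ n → ℤ
⟨ u , v ⟩ = sumℤ (λ i → u i * v i)

module _ {n : ℕ} (P : FinPoset n) where
  InCone : Vecℤ n → Set
  InCone x = ∀ i j → _<P_ P i j → x i ≤ x j

  IsRayGen : Vecℤ n → Set
  IsRayGen v =
      InCone v
    × ¬ (v ≈N zeroV)
    × (∀ (k : ℕ) (w : Vecℤ n) → v ≈N (k · w) → k ≡ 1)
    -- extremal: any decomposition of a positive multiple of v inside σ_P
    -- has summands on the ray ℝ≥0 v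
    × (∀ (k : ℕ) (a b : Vecℤ n) → k ≢ 0 → InCone a → InCone b →
         (a ⊕ b) ≈N (k · v) →
         Σ ℕ λ p → Σ ℕ λ q → q ≢ 0 × ((q · a) ≈N (p · v)))

  QGorenstein : Set
  QGorenstein = Σ (Vecℤ n) λ u → InM u × Σ ℕ λ r → r ≢ 0 ×
                  (∀ v → IsRayGen v → ⟨ u , v ⟩ ≡ + r)

  Gorenstein : Set
  Gorenstein = Σ (Vecℤ n) λ u → InM u ×
                  (∀ v → IsRayGen v → ⟨ u , v ⟩ ≡ + 1)

-- Let u ∈ M be a witness of ℚ-Gorensteinness: ⟨u, v⟩ = r for every ray generator v. The ray
-- generators of σ_P are the indicator vectors 𝟙_U of the upper sets U with U and P ∖ U nonempty
-- and connected, so it suffices to show that r divides every coordinate u_x = ⟨u, 𝟙_{x}⟩; then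
-- u / r is a Gorenstein witness. Call U ⊆ S a connected cut of S if U is an upper set of S and
-- U, S ∖ U are nonempty and connected, and call a connected S divisible if r divides ⟨u, 𝟙_S⟩
-- and ⟨u, 𝟙_U⟩ for every connected cut U of S. P itself is divisible, and when w ∉ S is
-- adjacent to S, divisibility of S ∪ {w} passes down to S: as w is minimal or maximal, either S
-- or {w} is a connected cut of S ∪ {w}, and every connected cut U of S lifts to the connected
-- cut U or U ∪ {w} of S ∪ {w}. Shrinking P one vertex at a time reaches every singleton.

module Submission where

open import Defs
open import Data.Nat using (ℕ; zero; suc; _≤_; z≤n; NonZero)
import Data.Nat.Properties as ℕ
open import Data.Integer as ℤ using (ℤ; +_; 0ℤ; 1ℤ; _+_; _*_; _-_; ∣_∣)
import Data.Integer.Properties as ℤ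
open import Data.Integer.Divisibility.Signed
  using (_∣_; divides; ∣-reflexive; ∣m+n∣m⇒∣n; ∣m+n∣n⇒∣m)
open import Data.Integer.Tactic.RingSolver using (solve-∀)
open import Algebra.Properties.Semiring.Sum ℤ.+-*-semiring
  using (sum; sum-cong-≗; ∑-distrib-+; *-distribʳ-sum)
open import Data.Fin using (Fin; zero; suc)
open import Data.Fin.Properties using (any?; all?; ¬∀⟶∃¬)
open import Data.Fin.Subset using (Subset; _∈_; _∉_; ⁅_⁆; _∪_; ⊥; Nonempty; _⊃_)
open import Data.Fin.Subset.Properties
  using (_∈?_; x∈⁅x⁆; x∈⁅y⁆⇒x≡y; x∈p∪q⁺; x∈p∪q⁻)
open import Data.Fin.Subset.Induction using (⊃-wellFounded; Acc; acc)
open import Data.Vec.Functional using (tail)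
open import Data.Bool using (if_then_else_)
open import Data.Product using (Σ; ∃; ∃₂; _×_; _,_; proj₁; proj₂)
open import Data.Sum as Sum using (_⊎_; inj₁; inj₂; [_,_]′)
open import Function using (_∘_; case_of_)
open import Function.Bundles using (_⇔_; mk⇔)
open import Level using (Level; 0ℓ)
open import Relation.Nullary using (¬_; yes; no; does; contradiction; ¬?)
open import Relation.Nullary.Decidable using (dec-true; dec-false; _×-dec_; T?)
open import Relation.Unary using (Pred; Decidable)
open import Relation.Binary using (Rel; Symmetric)
open import Relation.Binary.PropositionalEquality
open import Relation.Binary.Construct.Closure.ReflexiveTransitive as Star
  using (Star; ε; _◅_; _◅◅_)

private
  variable
    n : ℕ

i≤j∧k≤l∧i+k≡j+l⇒i≡j : ∀ {i j k l} → i ℤ.≤ j → k ℤ.≤ l → i + k ≡ j + l → i ≡ j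
i≤j∧k≤l∧i+k≡j+l⇒i≡j i≤j k≤l eq =
  ℤ.≤-antisym i≤j (ℤ.≮⇒≥ (λ i<j → ℤ.<-irrefl eq (ℤ.+-mono-<-≤ i<j k≤l)))

sumℤ≡sum : (f : Vecℤ n) → sumℤ f ≡ sum f
sumℤ≡sum {zero}  f = refl
sumℤ≡sum {suc n} f = cong (λ t → f zero + t) (sumℤ≡sum (tail f))

sumℤ-cong : {f g : Vecℤ n} → (∀ i → f i ≡ g i) → sumℤ f ≡ sumℤ g
sumℤ-cong {f = f} {g} f≗g = begin
  sumℤ f  ≡⟨ sumℤ≡sum f ⟩
  sum f   ≡⟨ sum-cong-≗ f≗g ⟩
  sum g   ≡⟨ sumℤ≡sum g ⟨
  sumℤ g  ∎
  where open ≡-Reasoning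

sumℤ-distrib-+ : (f g : Vecℤ n) → sumℤ (λ i → f i + g i) ≡ sumℤ f + sumℤ g
sumℤ-distrib-+ f g = begin
  sumℤ (λ i → f i + g i)  ≡⟨ sumℤ≡sum (λ i → f i + g i) ⟩
  sum (λ i → f i + g i)   ≡⟨ ∑-distrib-+ f g ⟩
  sum f + sum g           ≡⟨ cong₂ _+_ (sumℤ≡sum f) (sumℤ≡sum g) ⟨
  sumℤ f + sumℤ g         ∎
  where open ≡-Reasoning

sumℤ-distribʳ-* : (f : Vecℤ n) (c : ℤ) → sumℤ (λ i → f i * c) ≡ sumℤ f * c
sumℤ-distribʳ-* f c = begin
  sumℤ (λ i → f i * c)  ≡⟨ sumℤ≡sum (λ i → f i * c) ⟩
  sum (λ i → f i * c)   ≡⟨ *-distribʳ-sum c f ⟨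
  sum f * c             ≡⟨ cong (_* c) (sumℤ≡sum f) ⟨
  sumℤ f * c            ∎
  where open ≡-Reasoning

⟨⟩-congʳ : (u : Vecℤ n) {v v′ : Vecℤ n} → (∀ i → v i ≡ v′ i) → ⟨ u , v ⟩ ≡ ⟨ u , v′ ⟩
⟨⟩-congʳ u v≗v′ = sumℤ-cong (λ i → cong (u i *_) (v≗v′ i))

⟨⟩-distribʳ-⊕ : (u v w : Vecℤ n) → ⟨ u , v ⊕ w ⟩ ≡ ⟨ u , v ⟩ + ⟨ u , w ⟩
⟨⟩-distribʳ-⊕ u v w =
  trans (sumℤ-cong (λ i → ℤ.*-distribˡ-+ (u i) (v i) (w i)))
        (sumℤ-distrib-+ (λ i → u i * v i) (λ i → u i * w i))

⟨⟩-scaleˡ : (k v : Vecℤ n) (c : ℤ) → ⟨ (λ i → k i * c) , v ⟩ ≡ ⟨ k , v ⟩ * c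
⟨⟩-scaleˡ k v c = trans (sumℤ-cong (λ i → swap (k i) c (v i))) (sumℤ-distribʳ-* (λ i → k i * v i) c)
  where
  swap : ∀ a b x → a * b * x ≡ a * x * b
  swap = solve-∀

insert-new : (w : Fin n) (S : Subset n) → w ∈ ⁅ w ⁆ ∪ S
insert-new w S = x∈p∪q⁺ (inj₁ (x∈⁅x⁆ w))

insert-old : (w : Fin n) {S : Subset n} {x : Fin n} → x ∈ S → x ∈ ⁅ w ⁆ ∪ S
insert-old w x∈S = x∈p∪q⁺ (inj₂ x∈S)

insert⁻ : (w : Fin n) (S : Subset n) {x : Fin n} → x ∈ ⁅ w ⁆ ∪ S → x ≡ w ⊎ x ∈ S
insert⁻ w S = Sum.map₁ (x∈⁅y⁆⇒x≡y w) ∘ x∈p∪q⁻ ⁅ w ⁆ S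

insert-∉ : {w x : Fin n} {S : Subset n} → x ∉ S → x ≢ w → x ∉ ⁅ w ⁆ ∪ S
insert-∉ {w = w} {S = S} x∉S x≢w = [ x≢w , x∉S ]′ ∘ insert⁻ w S

𝟙 : Subset n → Vecℤ n
𝟙 S i = if does (i ∈? S) then 1ℤ else 0ℤ

𝟙-∈ : {S : Subset n} {x : Fin n} → x ∈ S → 𝟙 S x ≡ 1ℤ
𝟙-∈ {S = S} {x} x∈S rewrite dec-true (x ∈? S) x∈S = refl

𝟙-∉ : {S : Subset n} {x : Fin n} → x ∉ S → 𝟙 S x ≡ 0ℤ
𝟙-∉ {S = S} {x} x∉S rewrite dec-false (x ∈? S) x∉S = refl

𝟙-∪ : {S T : Subset n} → (∀ {x} → x ∈ S → x ∉ T) → ∀ i → 𝟙 (S ∪ T) i ≡ 𝟙 S i + 𝟙 T i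
𝟙-∪ {S = S} {T} disjoint i with i ∈? S | i ∈? T
... | yes i∈S | yes i∈T = contradiction i∈T (disjoint i∈S)
... | yes i∈S | no  i∉T = 𝟙-∈ (x∈p∪q⁺ {p = S} {T} (inj₁ i∈S))
... | no  i∉S | yes i∈T = 𝟙-∈ (x∈p∪q⁺ {p = S} {T} (inj₂ i∈T))
... | no  i∉S | no  i∉T = 𝟙-∉ ([ i∉S , i∉T ]′ ∘ x∈p∪q⁻ S T)

⟨⟩-𝟙⊥ : (u : Vecℤ n) → ⟨ u , 𝟙 ⊥ ⟩ ≡ 0ℤ
⟨⟩-𝟙⊥ {zero}  u = refl
⟨⟩-𝟙⊥ {suc n} u = cong₂ _+_ (ℤ.*-zeroʳ (u zero)) (⟨⟩-𝟙⊥ (tail u))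

⟨⟩-𝟙⁅⁆ : (u : Vecℤ n) (w : Fin n) → ⟨ u , 𝟙 ⁅ w ⁆ ⟩ ≡ u w
⟨⟩-𝟙⁅⁆ {suc n} u zero =
  trans (cong₂ _+_ (ℤ.*-identityʳ (u zero)) (⟨⟩-𝟙⊥ (tail u))) (ℤ.+-identityʳ _)
⟨⟩-𝟙⁅⁆ {suc n} u (suc w) =
  trans (cong₂ _+_ (ℤ.*-zeroʳ (u zero)) (⟨⟩-𝟙⁅⁆ (tail u) w)) (ℤ.+-identityˡ _)

⟨⟩-𝟙-insert : (u : Vecℤ n) {w : Fin n} {U : Subset n} → w ∉ U →
              ⟨ u , 𝟙 (⁅ w ⁆ ∪ U) ⟩ ≡ u w + ⟨ u , 𝟙 U ⟩
⟨⟩-𝟙-insert u {w} {U} w∉U = begin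
  ⟨ u , 𝟙 (⁅ w ⁆ ∪ U) ⟩         ≡⟨ ⟨⟩-congʳ u (𝟙-∪ disjoint) ⟩
  ⟨ u , 𝟙 ⁅ w ⁆ ⊕ 𝟙 U ⟩         ≡⟨ ⟨⟩-distribʳ-⊕ u _ _ ⟩
  ⟨ u , 𝟙 ⁅ w ⁆ ⟩ + ⟨ u , 𝟙 U ⟩  ≡⟨ cong (_+ ⟨ u , 𝟙 U ⟩) (⟨⟩-𝟙⁅⁆ u w) ⟩
  u w + ⟨ u , 𝟙 U ⟩              ∎
  where
  open ≡-Reasoning
  disjoint : ∀ {x} → x ∈ ⁅ w ⁆ → x ∉ U
  disjoint x∈w rewrite x∈⁅y⁆⇒x≡y w x∈w = w∉U

⟨⟩-𝟙-full : (u : Vecℤ n) {S : Subset n} → (∀ x → x ∈ S) → ⟨ u , 𝟙 S ⟩ ≡ sumℤ u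
⟨⟩-𝟙-full u full = sumℤ-cong (λ i → trans (cong (u i *_) (𝟙-∈ (full i))) (ℤ.*-identityʳ (u i)))

module _ {a r : Level} {A : Set a} (R : Rel A r) where

  EdgeWithin : ∀ {p} → Pred A p → Rel A _
  EdgeWithin X x y = X x × X y × R x y

  Connected : ∀ {p} → Pred A p → Set _
  Connected X = ∀ {x y} → X x → X y → Star (EdgeWithin X) x y

module _ {a r p q : Level} {A : Set a} {R : Rel A r} {X : Pred A p} {Y : Pred A q} where

  within-mono : (∀ {x} → X x → Y x) → ∀ {x y} → Star (EdgeWithin R X) x y → Star (EdgeWithin R Y) x y
  within-mono X⊆Y = Star.map (λ (Xx , Xy , xy) → X⊆Y Xx , X⊆Y Xy , xy)

  connected-resp : (∀ {x} → X x → Y x) → (∀ {x} → Y x → X x) → Connected R X → Connected R Y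
  connected-resp X⊆Y Y⊆X conn Yx Yy = within-mono X⊆Y (conn (Y⊆X Yx) (Y⊆X Yy))

  connected-extend : Symmetric R → ∀ {w c} → (∀ {x} → X x → Y x) → (∀ {x} → Y x → x ≡ w ⊎ X x) →
                     Y w → X c → R w c → Connected R X → Connected R Y
  connected-extend sym X⊆Y Y⊆w∪X Yw Xc wc conn {x} {y} Yx Yy with Y⊆w∪X Yx | Y⊆w∪X Yy
  ... | inj₁ refl | inj₁ refl = ε
  ... | inj₁ refl | inj₂ Xy   = (Yw , X⊆Y Xc , wc) ◅ within-mono X⊆Y (conn Xc Xy)
  ... | inj₂ Xx   | inj₁ refl = within-mono X⊆Y (conn Xx Xc) ◅◅ ((X⊆Y Xc , Yw , sym wc) ◅ ε)
  ... | inj₂ Xx   | inj₂ Xy   = within-mono X⊆Y (conn Xx Xy)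

module _ {a r p : Level} {A : Set a} {R : Rel A r} {X : Pred A p} where

  connected-singleton : ∀ {w} → (∀ {x} → X x → x ≡ w) → Connected R X
  connected-singleton X⊆w Xx Xy with X⊆w Xx | X⊆w Xy
  ... | refl | refl = ε

  crossing-edge : Decidable X → ∀ {x y} → Star R x y → X x → ¬ X y → ∃₂ λ c d → R c d × X c × ¬ X d
  crossing-edge X? ε Xx ¬Xy = contradiction Xx ¬Xy
  crossing-edge X? (_◅_ {j = z} xz zy) Xx ¬Xy with X? z
  ... | yes Xz  = crossing-edge X? zy Xz ¬Xy
  ... | no  ¬Xz = _ , _ , xz , Xx , ¬Xz

-- Connected cuts and ray generators of the braid cone

module _ {n : ℕ} (P : FinPoset n) where
  open FinPoset P using (lt)

  private
    _<_ : Fin n → Fin n → Set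
    _<_ = _<P_ P

  Comparable : Rel (Fin n) _
  Comparable x y = x < y ⊎ y < x

  comparable-sym : Symmetric Comparable
  comparable-sym = Sum.swap

  hasse⇒comparable : HasseConnected P → ∀ x y → Star Comparable x y
  hasse⇒comparable hasse x y = Star.map (Sum.map proj₁ proj₁) (hasse x y)

  record ConnectedCut (S U : Subset n) : Set where
    field
      ⊆S           : ∀ {x} → x ∈ U → x ∈ S
      upward       : ∀ {x y} → x < y → x ∈ U → y ∈ S → y ∈ U
      inhabited    : Nonempty U
      co-inhabited : ∃ λ x → x ∈ S × x ∉ U
      connected    : Connected Comparable (_∈ U)
      co-connected : Connected Comparable (λ x → x ∈ S × x ∉ U)

  module _ {a b : Vecℤ n} (a∈σ : InCone P a) (b∈σ : InCone P b) {s : ℤ} {X : Pred (Fin n) 0ℓ}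
           (a+b≡s : ∀ {x} → X x → a x + b x ≡ s) where

    cone-summand-constant : ∀ {x y} → Star (EdgeWithin Comparable X) x y → a x ≡ a y
    cone-summand-constant ε = refl
    cone-summand-constant ((Xx , Xy , inj₁ x<y) ◅ rest) =
      trans (i≤j∧k≤l∧i+k≡j+l⇒i≡j (a∈σ _ _ x<y) (b∈σ _ _ x<y) (trans (a+b≡s Xx) (sym (a+b≡s Xy))))
            (cone-summand-constant rest)
    cone-summand-constant ((Xx , Xy , inj₂ y<x) ◅ rest) =
      trans (sym (i≤j∧k≤l∧i+k≡j+l⇒i≡j (a∈σ _ _ y<x) (b∈σ _ _ y<x) (trans (a+b≡s Xy) (sym (a+b≡s Xx)))))
            (cone-summand-constant rest)

  module RayGenerator (path : ∀ x y → Star Comparable x y)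
                      {S U : Subset n} (full : ∀ x → x ∈ S) (cut : ConnectedCut S U) where
    open ConnectedCut cut

    x₀ x₁ : Fin n
    x₀ = proj₁ inhabited
    x₁ = proj₁ co-inhabited

    x₀∈U : x₀ ∈ U
    x₀∈U = proj₂ inhabited

    x₁∉U : x₁ ∉ U
    x₁∉U = proj₂ (proj₂ co-inhabited)

    in-cone : InCone P (𝟙 U)
    in-cone i j i<j with i ∈? U | j ∈? U
    ... | yes _   | yes _   = ℤ.≤-refl
    ... | yes i∈U | no  j∉U = contradiction (upward i<j i∈U (full j)) j∉U
    ... | no  _   | yes _   = ℤ.+≤+ z≤n
    ... | no  _   | no  _   = ℤ.≤-refl

    is-primitive : ∀ (k : ℕ) (w : Vecℤ n) → 𝟙 U ≈N (k · w) → k ≡ 1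
    is-primitive k w (c , 𝟙≈kw) =
      ℕ.m*n≡1⇒m≡1 k _ (trans (sym (ℤ.abs-* (+ k) (w x₀ - w x₁))) (cong ∣_∣ k[w₀-w₁]≡1))
      where
      expand : ∀ K p q c → K * (p - q) ≡ (K * p + c) - (K * q + c)
      expand = solve-∀
      k[w₀-w₁]≡1 : + k * (w x₀ - w x₁) ≡ 1ℤ
      k[w₀-w₁]≡1 = begin
        + k * (w x₀ - w x₁)                        ≡⟨ expand (+ k) (w x₀) (w x₁) c ⟩
        (+ k * w x₀ + c) - (+ k * w x₁ + c)        ≡⟨ cong₂ _-_ (𝟙≈kw x₀) (𝟙≈kw x₁) ⟨
        𝟙 U x₀ - 𝟙 U x₁                            ≡⟨ cong₂ _-_ (𝟙-∈ x₀∈U) (𝟙-∉ x₁∉U) ⟩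
        1ℤ                                         ∎
        where open ≡-Reasoning

    -- A vector ≈ 0 is 0 · w for any w, which primitivity forbids.
    nonzero : ¬ (𝟙 U ≈N zeroV)
    nonzero (c , 𝟙≈0) = case is-primitive 0 zeroV (c , 𝟙≈0) of λ ()

    -- A summand a of k·𝟙_U in σ_P is constant on the connected sets U and S ∖ U, and its
    -- value α on U is at least its value β below, so a ≈ (α - β) · 𝟙_U.
    extremal : ∀ (k : ℕ) (a b : Vecℤ n) → k ≢ 0 → InCone P a → InCone P b → (a ⊕ b) ≈N (k · 𝟙 U) →
               Σ ℕ λ p → Σ ℕ λ q → q ≢ 0 × ((q · a) ≈N (p · 𝟙 U))
    extremal k a b _ a∈σ b∈σ (c , a+b≈k𝟙) = ∣ α - β ∣ , 1 , (λ ()) , β , a≈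
      where
      α β : ℤ
      α = a x₀
      β = a x₁

      on-U : ∀ {x} → x ∈ U → a x ≡ α
      on-U x∈U = cone-summand-constant a∈σ b∈σ
                   (λ y∈U → trans (a+b≈k𝟙 _) (cong (λ t → + k * t + c) (𝟙-∈ y∈U)))
                   (connected x∈U x₀∈U)

      off-U : ∀ {x} → x ∉ U → a x ≡ β
      off-U x∉U = cone-summand-constant a∈σ b∈σ
                    (λ y∉U → trans (a+b≈k𝟙 _) (cong (λ t → + k * t + c) (𝟙-∉ (proj₂ y∉U))))
                    (co-connected (full _ , x∉U) (full _ , x₁∉U))

      β≤α : β ℤ.≤ α
      β≤α with crossing-edge (_∈? U) (path x₀ x₁) x₀∈U x₁∉U
      ... | x , y , inj₁ x<y , x∈U , y∉U = contradiction (upward x<y x∈U (full y)) y∉U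
      ... | x , y , inj₂ y<x , x∈U , y∉U = subst₂ ℤ._≤_ (off-U y∉U) (on-U x∈U) (a∈σ y x y<x)

      ∣α-β∣≡α-β : + ∣ α - β ∣ ≡ α - β
      ∣α-β∣≡α-β = ℤ.0≤i⇒+∣i∣≡i (ℤ.i≤j⇒0≤j-i β≤α)

      a-values : ∀ i → a i ≡ (α - β) * 𝟙 U i + β
      a-values i with i ∈? U
      ... | yes i∈U = trans (on-U i∈U) (above α β)
        where
        above : ∀ x y → x ≡ (x - y) * 1ℤ + y
        above = solve-∀
      ... | no  i∉U = trans (off-U i∉U) (below α β)
        where
        below : ∀ x y → y ≡ (x - y) * 0ℤ + y
        below = solve-∀

      a≈ : ∀ i → + 1 * a i ≡ + ∣ α - β ∣ * 𝟙 U i + β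
      a≈ i = trans (ℤ.*-identityˡ (a i)) (trans (a-values i) (cong (λ t → t * 𝟙 U i + β) (sym ∣α-β∣≡α-β)))

    isRayGen : IsRayGen P (𝟙 U)
    isRayGen = in-cone , nonzero , is-primitive , extremal

  LiftedCut : Subset n → Fin n → Subset n → Set
  LiftedCut S w U = ConnectedCut (⁅ w ⁆ ∪ S) U ⊎ ConnectedCut (⁅ w ⁆ ∪ S) (⁅ w ⁆ ∪ U)

  module _ {S U : Subset n} {w : Fin n} (cut : ConnectedCut S U) (w∉S : w ∉ S) where
    open ConnectedCut cut

    private
      w∉U : w ∉ U
      w∉U = w∉S ∘ ⊆S

    extend-below : (∀ {x} → x ∈ U → ¬ x < w) → (∃ λ z → z ∈ S × z ∉ U × Comparable w z) →
                   ConnectedCut (⁅ w ⁆ ∪ S) U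
    extend-below U≮w (z , z∈S , z∉U , wz) = record
      { ⊆S           = insert-old w ∘ ⊆S
      ; upward       = λ {x} {y} x<y x∈U y∈T → [ (λ { refl → contradiction x<y (U≮w x∈U) })
                                                 , upward x<y x∈U ]′ (insert⁻ w S y∈T)
      ; inhabited    = inhabited
      ; co-inhabited = let (x , x∈S , x∉U) = co-inhabited in x , insert-old w x∈S , x∉U
      ; connected    = connected
      ; co-connected = connected-extend comparable-sym
                         (λ (x∈S , x∉U) → insert-old w x∈S , x∉U)
                         (λ {x} (x∈T , x∉U) → Sum.map₂ (_, x∉U) (insert⁻ w S x∈T))
                         (insert-new w S , w∉U) (z∈S , z∉U) wz co-connected
      }

    extend-above : (∀ {y} → y ∈ S → w < y → y ∈ U) → (∃ λ z → z ∈ U × Comparable w z) →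
                   ConnectedCut (⁅ w ⁆ ∪ S) (⁅ w ⁆ ∪ U)
    extend-above w<S⇒U (z , z∈U , wz) = record
      { ⊆S           = [ (λ { refl → insert-new w S }) , insert-old w ∘ ⊆S ]′ ∘ insert⁻ w U
      ; upward       = upward′
      ; inhabited    = w , insert-new w U
      ; co-inhabited = let (x , x∈S , x∉U) = co-inhabited in
                       x , insert-old w x∈S , insert-∉ x∉U (λ { refl → w∉S x∈S })
      ; connected    = connected-extend comparable-sym (insert-old w) (insert⁻ w U) (insert-new w U)
                         z∈U wz connected
      ; co-connected = connected-resp
                         (λ (x∈S , x∉U) → insert-old w x∈S , insert-∉ x∉U (λ { refl → w∉S x∈S }))
                         (λ {x} (x∈T , x∉U′) → [ (λ { refl → contradiction (insert-new w U) x∉U′ })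
                                                 , (λ x∈S → x∈S , x∉U′ ∘ insert-old w) ]′ (insert⁻ w S x∈T))
                         co-connected
      }
      where
      upward′ : ∀ {x y} → x < y → x ∈ ⁅ w ⁆ ∪ U → y ∈ ⁅ w ⁆ ∪ S → y ∈ ⁅ w ⁆ ∪ U
      upward′ {x} {y} x<y x∈U′ y∈T with insert⁻ w U x∈U′ | insert⁻ w S y∈T
      ... | _         | inj₁ refl = insert-new w U
      ... | inj₁ refl | inj₂ y∈S  = insert-old w (w<S⇒U y∈S x<y)
      ... | inj₂ x∈U  | inj₂ y∈S  = insert-old w (upward x<y x∈U y∈S)

  module _ {S : Subset n} {w c : Fin n} (w∉S : w ∉ S) (c∈S : c ∈ S)
           (S-connected : Connected Comparable (_∈ S)) where

    private
      lower-is-w : ∀ {x} → x ∈ ⁅ w ⁆ ∪ S × x ∉ S → x ≡ w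
      lower-is-w {x} (x∈T , x∉S) = [ (λ x≡w → x≡w) , (λ x∈S → contradiction x∈S x∉S) ]′ (insert⁻ w S x∈T)

    minimal-cut : (∀ j → ¬ j < w) → ConnectedCut (⁅ w ⁆ ∪ S) S
    minimal-cut w-min = record
      { ⊆S           = insert-old w
      ; upward       = λ {x} x<y x∈S y∈T → [ (λ { refl → contradiction x<y (w-min x) }) , (λ y∈S → y∈S) ]′
                                            (insert⁻ w S y∈T)
      ; inhabited    = c , c∈S
      ; co-inhabited = w , insert-new w S , w∉S
      ; connected    = S-connected
      ; co-connected = connected-singleton lower-is-w
      }

    maximal-cut : (∀ j → ¬ w < j) → ConnectedCut (⁅ w ⁆ ∪ S) ⁅ w ⁆
    maximal-cut w-max = record
      { ⊆S           = λ x∈w → subst (_∈ ⁅ w ⁆ ∪ S) (sym (x∈⁅y⁆⇒x≡y w x∈w)) (insert-new w S)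
      ; upward       = λ {x} x<y x∈w _ → contradiction (subst (_< _) (x∈⁅y⁆⇒x≡y w x∈w) x<y) (w-max _)
      ; inhabited    = w , x∈⁅x⁆ w
      ; co-inhabited = c , insert-old w c∈S , λ c∈w → w∉S (subst (_∈ S) (x∈⁅y⁆⇒x≡y w c∈w) c∈S)
      ; connected    = connected-singleton (x∈⁅y⁆⇒x≡y w)
      ; co-connected = connected-resp
                         (λ x∈S → insert-old w x∈S , λ x∈w → w∉S (subst (_∈ S) (x∈⁅y⁆⇒x≡y w x∈w) x∈S))
                         (λ {x} (x∈T , x∉w) → [ (λ { refl → contradiction (x∈⁅x⁆ w) x∉w }) , (λ x∈S → x∈S) ]′
                                               (insert⁻ w S x∈T))
                         S-connected
      }

    minimal-extend : (∀ j → ¬ j < w) → w < c → ∀ {U} → ConnectedCut S U → LiftedCut S w U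
    minimal-extend w-min w<c {U} cut with any? (λ z → (z ∈? S) ×-dec (¬? (z ∈? U)) ×-dec T? (lt w z))
    ... | yes (z , z∈S , z∉U , w<z) =
      inj₁ (extend-below cut w∉S (λ {x} _ → w-min x) (z , z∈S , z∉U , inj₁ w<z))
    ... | no  none =
      inj₂ (extend-above cut w∉S above-w⊆U (c , above-w⊆U c∈S w<c , inj₁ w<c))
      where
      above-w⊆U : ∀ {y} → y ∈ S → w < y → y ∈ U
      above-w⊆U {y} y∈S w<y with y ∈? U
      ... | yes y∈U = y∈U
      ... | no  y∉U = contradiction (y , y∈S , y∉U , w<y) none

    maximal-extend : (∀ j → ¬ w < j) → c < w → ∀ {U} → ConnectedCut S U → LiftedCut S w U
    maximal-extend w-max c<w {U} cut with any? (λ z → (z ∈? U) ×-dec T? (lt z w))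
    ... | yes (z , z∈U , z<w) =
      inj₂ (extend-above cut w∉S (λ {y} _ w<y → contradiction w<y (w-max y)) (z , z∈U , inj₂ z<w))
    ... | no  none =
      inj₁ (extend-below cut w∉S U≮w (c , c∈S , c∉U , inj₂ c<w))
      where
      U≮w : ∀ {x} → x ∈ U → ¬ x < w
      U≮w x∈U x<w = none (_ , x∈U , x<w)
      c∉U : c ∉ U
      c∉U c∈U = U≮w c∈U c<w

  -- Divisibility of ⟨u, ·⟩ by r along connected cuts

  module Divisibility (u : Vecℤ n) (r : ℕ) where

    Divisible : Subset n → Set
    Divisible S = (∀ {U} → ConnectedCut S U → + r ∣ ⟨ u , 𝟙 U ⟩) × + r ∣ ⟨ u , 𝟙 S ⟩

    divisible-full : (∀ x y → Star Comparable x y) → (∀ v → IsRayGen P v → ⟨ u , v ⟩ ≡ + r) → InM u →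
                     ∀ {S} → (∀ x → x ∈ S) → Divisible S
    divisible-full path u-on-rays u∈M full =
        (λ cut → ∣-reflexive (sym (u-on-rays _ (RayGenerator.isRayGen path full cut))))
      , divides 0ℤ (trans (⟨⟩-𝟙-full u full) u∈M)

    divisible-shrink : ∀ {S w} → w ∉ S →
                       ConnectedCut (⁅ w ⁆ ∪ S) S ⊎ ConnectedCut (⁅ w ⁆ ∪ S) ⁅ w ⁆ →
                       (∀ {U} → ConnectedCut S U → LiftedCut S w U) →
                       Divisible (⁅ w ⁆ ∪ S) → Divisible S
    divisible-shrink {S} {w} w∉S isolating extend (on-cuts , on-T) = on-cuts′ , on-S
      where
      on-T′ : + r ∣ u w + ⟨ u , 𝟙 S ⟩
      on-T′ = subst (+ r ∣_) (⟨⟩-𝟙-insert u w∉S) on-T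

      on-w : + r ∣ u w
      on-w = [ (λ S-cut → ∣m+n∣n⇒∣m on-T′ (on-cuts S-cut))
             , (λ w-cut → subst (+ r ∣_) (⟨⟩-𝟙⁅⁆ u w) (on-cuts w-cut)) ]′ isolating

      on-S : + r ∣ ⟨ u , 𝟙 S ⟩
      on-S = ∣m+n∣m⇒∣n on-T′ on-w

      on-cuts′ : ∀ {U} → ConnectedCut S U → + r ∣ ⟨ u , 𝟙 U ⟩
      on-cuts′ cut = [ on-cuts , (λ cut′ → ∣m+n∣m⇒∣n (on-insert cut′) on-w) ]′ (extend cut)
        where
        on-insert : ConnectedCut (⁅ w ⁆ ∪ S) (⁅ w ⁆ ∪ _) → + r ∣ u w + ⟨ u , 𝟙 _ ⟩
        on-insert cut′ = subst (+ r ∣_) (⟨⟩-𝟙-insert u (w∉S ∘ ConnectedCut.⊆S cut)) (on-cuts cut′)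

    module _ (length1 : Length1 P) (path : ∀ x y → Star Comparable x y)
             (u-on-rays : ∀ v → IsRayGen P v → ⟨ u , v ⟩ ≡ + r) (u∈M : InM u) where

      divisible-connected : ∀ {S} → Acc _⊃_ S → Nonempty S → Connected Comparable (_∈ S) → Divisible S
      divisible-connected {S} (acc smaller) (s , s∈S) S-connected with all? (_∈? S)
      ... | yes full = divisible-full path u-on-rays u∈M full
      ... | no  ¬full with ¬∀⟶∃¬ n (_∈ S) (_∈? S) ¬full
      ...   | y , y∉S with crossing-edge (_∈? S) (path s y) s∈S y∉S
      ...     | c , w , cw , c∈S , w∉S = divisible-shrink w∉S isolating extend (divisible-connected
                                           (smaller (insert-old w , w , insert-new w S , w∉S))
                                           (w , insert-new w S) T-connected)
        where
        T-connected : Connected Comparable (_∈ ⁅ w ⁆ ∪ S)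
        T-connected = connected-extend comparable-sym (insert-old w) (insert⁻ w S) (insert-new w S) c∈S
                        (comparable-sym cw) S-connected

        isolating : ConnectedCut (⁅ w ⁆ ∪ S) S ⊎ ConnectedCut (⁅ w ⁆ ∪ S) ⁅ w ⁆
        isolating = Sum.map (minimal-cut w∉S c∈S S-connected) (maximal-cut w∉S c∈S S-connected) (length1 w)

        extend : ∀ {U} → ConnectedCut S U → LiftedCut S w U
        extend with length1 w
        ... | inj₁ w-min = minimal-extend w∉S c∈S S-connected w-min
                             ([ (λ c<w → contradiction c<w (w-min c)) , (λ w<c → w<c) ]′ cw)
        ... | inj₂ w-max = maximal-extend w∉S c∈S S-connected w-max
                             ([ (λ c<w → c<w) , (λ w<c → contradiction w<c (w-max c)) ]′ cw)

      divides-coordinates : ∀ x → + r ∣ u x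
      divides-coordinates x = subst (+ r ∣_) (⟨⟩-𝟙⁅⁆ u x)
        (proj₂ (divisible-connected (⊃-wellFounded ⁅ x ⁆) (x , x∈⁅x⁆ x)
                  (connected-singleton (x∈⁅y⁆⇒x≡y x))))

  gorenstein-from-divisible : (u : Vecℤ n) (r : ℕ) .{{_ : NonZero r}} → (∀ x → + r ∣ u x) → InM u →
                              (∀ v → IsRayGen P v → ⟨ u , v ⟩ ≡ + r) → Gorenstein P
  gorenstein-from-divisible u r r∣u u∈M u-on-rays = k , k∈M , k-on-rays
    where
    k : Vecℤ n
    k x = _∣_.quotient (r∣u x)

    u≡kr : ∀ x → u x ≡ k x * + r
    u≡kr x = _∣_.equality (r∣u x)

    k∈M : InM k
    k∈M = ℤ.*-cancelʳ-≡ (sumℤ k) 0ℤ (+ r)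
            (trans (sym (sumℤ-distribʳ-* k (+ r))) (trans (sym (sumℤ-cong u≡kr)) u∈M))

    k-on-rays : ∀ v → IsRayGen P v → ⟨ k , v ⟩ ≡ 1ℤ
    k-on-rays v v-ray = ℤ.*-cancelʳ-≡ ⟨ k , v ⟩ 1ℤ (+ r) (begin
      ⟨ k , v ⟩ * + r              ≡⟨ ⟨⟩-scaleˡ k v (+ r) ⟨
      ⟨ (λ i → k i * + r) , v ⟩    ≡⟨ sumℤ-cong (λ i → cong (_* v i) (u≡kr i)) ⟨
      ⟨ u , v ⟩                    ≡⟨ u-on-rays v v-ray ⟩
      + r                          ≡⟨ ℤ.*-identityˡ (+ r) ⟨
      1ℤ * + r                     ∎)
      where open ≡-Reasoning

theorem6p3 : (n : ℕ) → 2 ≤ n → (P : FinPoset n) → Length1 P → HasseConnected P →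
    Gorenstein P ⇔ QGorenstein P
theorem6p3 n _ P length1 hasse = mk⇔ gorenstein⇒qGorenstein qGorenstein⇒gorenstein
  where
  gorenstein⇒qGorenstein : Gorenstein P → QGorenstein P
  gorenstein⇒qGorenstein (u , u∈M , u-on-rays) = u , u∈M , 1 , (λ ()) , u-on-rays

  qGorenstein⇒gorenstein : QGorenstein P → Gorenstein P
  qGorenstein⇒gorenstein (u , u∈M , zero  , r≢0 , u-on-rays) = contradiction refl r≢0
  qGorenstein⇒gorenstein (u , u∈M , suc r , r≢0 , u-on-rays) =
    gorenstein-from-divisible P u (suc r)
      (Divisibility.divides-coordinates P u (suc r) length1 (hasse⇒comparable P hasse) u-on-rays u∈M)
      u∈M u-on-rays
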